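{- Let $H$ be a monotone integer priority queue such that Dijkstra's algorithm, when it uses $H$ with the integer tentative distances $D(v)$ as keys on instances of integer P-SSSP, processes the nodes in a full ordering (i.e., if $v_1,\dots,v_n$ is the processing order then $i<j \Rightarrow d(v_i)\le d(v_j)$). Consider an instance of floating point P-SSSP with minimum edge length $\delta>0$. Run Dijkstra's algorithm using $H$ as follows: whenever the floating point tentative distance $D(u)$ of a node $u$ is set or decreased, its integer key $\hat D(u)=\lfloor D(u)/\delta\rfloor$ (conversion to an integer with truncation) is recomputed and $u$'s position in $H$ is updated using $\hat D(u)$; the next node to be processed is the one extracted from $H$. Then the resulting processing order $v_1,\dots,v_n$ is a $\delta$-PO, i.e., for all $i<j$, $d(v_i)<d(v_j)+\delta$.
   Context: A graph $G=(V,E)$ has finitely many nodes $n=|V|$ and edges $m=|E|$, edges directed (or undirected), each edge $\varepsilon$ having a length $\ell(\varepsilon)$. A source node $s\in V$ is given and $d(v)$ denotes the length of a shortest path from $s$ to $v$. SSSP asks for $d(v)$ for all $v$ together with a shortest-path tree (parent pointers). P-SSSP is the case where all edge lengths satisfy $0<\delta\le \ell(\varepsilon)$, where $\delta=\min_{\varepsilon\in E}\ell(\varepsilon)$; "integer" or "floating point" refers to the type of the edge weights. Dijkstra's algorithm: initialize $D(v)=\infty$ for all $v$, $D(s)=0$; repeatedly "process" a not-yet-processed node $v$ (the first is $s$): set $d(v)$ to $D(v)$ and, for each out-neighbor $u$ with $D(v)+\ell(v,u)<D(u)$, set $D(u)=D(v)+\ell(v,u)$ and the parent of $u$ to $v$,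 updating the priority queue. The processing order is denoted $v_1,\dots,v_n$. A monotone integer priority queue stores nodes with integer keys, supports insertion/decrease-key, and its extract-min operation returns a node of minimum key, so that the extracted keys form a nondecreasing sequence. -}

module Defs where

open import Data.Nat as ℕ using (ℕ; zero; suc)
import Data.Nat.Properties as ℕP
open import Data.Integer as ℤ using (ℤ)
open import Data.Rational as ℚ using (ℚ; 0ℚ; floor; _÷_)
import Data.Rational.Properties as ℚP
open import Data.Fin as Fin using (Fin; toℕ; fromℕ<)
import Data.Fin.Properties as FinP
open import Data.Bool using (Bool; true; false; if_then_else_)
open import Data.Maybe using (Maybe; just; nothing)
open import Data.Product using (_×_; _,_; proj₁; proj₂; ∃)
open import Data.List as List using (List; []; _∷_; filter; reverse; length; lookup)
open import Data.List.Membership.Propositional using (_∈_)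
open import Data.List.Relation.Unary.All using (All)
open import Data.List.Relation.Unary.Any using (any?)
open import Relation.Nullary using (does; ¬_)
open import Relation.Binary using (Rel; Decidable)
open import Relation.Binary.PropositionalEquality using (_≡_)
open import Level using (0ℓ)

-- Abstract (integer) priority queue, modelled by its observable behaviour.
-- The queue sees the sequence of operations performed on it so far
-- (histories are stored NEWEST FIRST).  'upd v k' = insert v with key k,
-- or change the key of v to k (decrease-key); 'ext v' = the node v was
-- removed by extract-min.

data Op : Set where
  upd : ℕ → ℤ → Op
  ext : ℕ → Op

-- H n h : the answer of extract-min after history h, for a queue created
-- for a graph with n nodes ('nothing' = queue reports empty).
PQueue : Set
PQueue = ℕ → List Op → Maybe ℕ

remove : ℕ → List (ℕ × ℤ) → List (ℕ × ℤ)
remove v = filter (λ p → ¬? (proj₁ p ℕ.≟ v))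
  where open import Relation.Nullary.Decidable using (¬?)

contents : List Op → List (ℕ × ℤ)
contents [] = []
contents (upd v k ∷ h) = (v , k) ∷ remove v (contents h)
contents (ext v ∷ h) = remove v (contents h)

keyOf : ℕ → List (ℕ × ℤ) → Maybe ℤ
keyOf v [] = nothing
keyOf v ((w , k) ∷ c) = if does (w ℕ.≟ v) then just k else keyOf v c

lastExtKey : List Op → Maybe ℤ
lastExtKey [] = nothing
lastExtKey (upd _ _ ∷ h) = lastExtKey h
lastExtKey (ext v ∷ h) with keyOf v (contents h)
... | just k = just k
... | nothing = lastExtKey h

AtLeast : Maybe ℤ → ℤ → Set
AtLeast nothing k = Data.Unit.⊤ where import Data.Unit
AtLeast (just l) k = l ℤ.≤ k

MonoUse : List Op → Set
MonoUse [] = Data.Unit.⊤ where import Data.Unit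
MonoUse (upd v k ∷ h) = MonoUse h × AtLeast (lastExtKey h) k
MonoUse (ext v ∷ h) = MonoUse h

ExtractSpec : Maybe ℕ → List (ℕ × ℤ) → Set
ExtractSpec nothing c = c ≡ []
ExtractSpec (just v) c =
  ∃ λ k → ((v , k) ∈ c) × All (λ p → k ℤ.≤ proj₂ p) c

MonotoneIntPQ : PQueue → Set
MonotoneIntPQ H = ∀ n h → MonoUse h → ExtractSpec (H n h) (contents h)

module Generic (A : Set) (0A : A) (_+_ : A → A → A)
               (_≤_ : Rel A 0ℓ) (_<_ : Rel A 0ℓ) (_<?_ : Decidable _<_) where

  -- directed graph on nodes Fin n: list of edges (tail, head, length)
  Edges : ℕ → Set
  Edges n = List (Fin n × Fin n × A)

  module _ {n : ℕ} (s : Fin n) (E : Edges n) where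

    data Walk : Fin n → A → Set where
      here  : Walk s 0A
      there : ∀ {u w x ℓ} → Walk u x → (u , w , ℓ) ∈ E → Walk w (x + ℓ)

    IsDist : Fin n → A → Set
    IsDist v x = Walk v x × (∀ y → Walk v y → x ≤ y)

  record State (n : ℕ) : Set where
    field
      D     : Fin n → Maybe A        -- tentative distances (nothing = ∞)
      par   : Fin n → Maybe (Fin n)
      done  : List (Fin n)
      hist  : List Op                -- operations sent to H, newest first
      order : List (Fin n)           -- processing order, newest first

  setAt : ∀ {n} {B : Set} → (Fin n → B) → Fin n → B → Fin n → B
  setAt f u b w = if does (w Fin.≟ u) then b else f w

  improves : Maybe A → A → Bool
  improves nothing  y = true
  improves (just x) y = does (y <? x)

  module Run (key : A → ℤ) (H : PQueue) {n : ℕ} (s : Fin n) (E : Edges n) where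

    relax : A → Fin n → State n → Fin n × Fin n × A → State n
    relax dv v st (a , u , ℓ) =
      if does (a Fin.≟ v) ∧ improves (D u) (dv + ℓ)
      then record st
        { D    = setAt D u (just (dv + ℓ))
        ; par  = setAt par u (just v)
        ; hist = if does (any? (u Fin.≟_) done) then hist
                 else upd (toℕ u) (key (dv + ℓ)) ∷ hist }
      else st
      where open State st
            open import Data.Bool using (_∧_)

    process : State n → Fin n → State n
    process st v with State.D st v
    ... | nothing = st
    ... | just dv = List.foldl (relax dv v) st′ E
      where
      open State st
      st′ : State n
      st′ = record st { done = v ∷ done ; hist = ext (toℕ v) ∷ hist
                      ; order = v ∷ order }

    step : State n → State n
    step st with H n (State.hist st)
    ... | nothing = st
    ... | just m with m ℕ.<? n
    ...   | Relation.Nullary.no _ = st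
    ...   | Relation.Nullary.yes m<n = process st (fromℕ< m<n)

    init : State n
    init = record
      { D     = λ w → if does (w Fin.≟ s) then just 0A else nothing
      ; par   = λ _ → nothing
      ; done  = []
      ; hist  = upd (toℕ s) (key 0A) ∷ []
      ; order = [] }

    iter : ℕ → State n → State n
    iter zero    st = st
    iter (suc k) st = iter k (step st)

    processingOrder : List (Fin n)
    processingOrder = reverse (State.order (iter n init))

-- Integer P-SSSP (lengths in ℕ, all ≥ 1), keys D(v) themselves.

module IntG = Generic ℕ 0 ℕ._+_ ℕ._≤_ ℕ._<_ ℕ._<?_

intOrder : PQueue → (n : ℕ) → Fin n → IntG.Edges n → List (Fin n)
intOrder H n s E = IntG.Run.processingOrder ℤ.+_ H s E

PositiveInt : ∀ {n} → IntG.Edges n → Set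
PositiveInt E = All (λ e → 0 ℕ.< proj₂ (proj₂ e)) E

FullOrderingOnIntegerPSSSP : PQueue → Set
FullOrderingOnIntegerPSSSP H =
  ∀ (n : ℕ) (s : Fin n) (E : IntG.Edges n) → PositiveInt E →
  let ord = intOrder H n s E in
  ∀ (i j : Fin (length ord)) → i Fin.< j →
  ∀ x y → IntG.IsDist s E (lookup ord i) x → IntG.IsDist s E (lookup ord j) y →
  x ℕ.≤ y

-- "Floating point" P-SSSP, modelled with exact rational lengths.

module RatG = Generic ℚ 0ℚ ℚ._+_ ℚ._≤_ ℚ._<_ ℚP._<?_

IsMinLength : ∀ {n} → RatG.Edges n → ℚ → Set
IsMinLength E δ =
  (0ℚ ℚ.< δ) × All (λ e → δ ℚ.≤ proj₂ (proj₂ e)) E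
  × ∃ λ e → (e ∈ E) × (proj₂ (proj₂ e) ≡ δ)

scaledKey : (δ : ℚ) → 0ℚ ℚ.< δ → ℚ → ℤ
scaledKey δ δ>0 x = floor ((x ÷ δ) {{ℚ.>-nonZero δ>0}})

ratOrder : PQueue → (n : ℕ) → Fin n → RatG.Edges n →
           (δ : ℚ) → 0ℚ ℚ.< δ → List (Fin n)
ratOrder H n s E δ δ>0 = RatG.Run.processingOrder (scaledKey δ δ>0) H s E

module Submission where

-- Two facts about the scaled key drive the argument (section ScaledKey):
-- it is monotone, and key x ≤ key y implies x < y + δ.  Running Dijkstra we
-- maintain an invariant of the state (QueueInvariant, DijkstraInvariant):
-- tentative distances are walk lengths, processed nodes carry their exact
-- distance, the queue holds exactly the unprocessed reached nodes with their
-- current keys, H has been used monotonically, all edges leaving processed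
-- nodes are relaxed, and the keys ⌊d(v)/δ⌋ of processed nodes are sorted
-- along the processing order and bounded by the last extracted key.
-- The heart is that an extracted node v is final (extracted-is-final): a
-- walk to v leaves the processed set at a frontier node b, and either b = v
-- or D(b) + δ ≤ |walk| (edges have length ≥ δ), while minimality of v's key
-- gives D(v) < D(b) + δ.  Use of H stays monotone because relaxing out of v
-- only creates keys ≥ key d(v).  The theorem then follows from the sorted
-- keys and the key fact.

open import Defs
open import Data.Nat using (ℕ)
open import Data.Fin as Fin using (Fin)
open import Data.List using (length; lookup)
open import Data.Product using (proj₁)
open import Data.Rational as ℚ using (ℚ)

import Data.Nat as ℕ
open import Data.Nat.Coprimality using (1-coprimeTo) renaming (sym to coprime-sym)
open import Data.Integer as ℤ using (ℤ)
import Data.Integer.Properties as ℤP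
import Data.Integer.DivMod as ℤD
open import Data.Rational using (mkℚ; floor; _÷_; ↧_; 0ℚ; 1ℚ)
import Data.Rational.Properties as ℚP
import Data.Rational.Unnormalised as ℚᵘ
import Data.Rational.Unnormalised.Properties as ℚᵘP
open import Data.Fin using (toℕ; fromℕ<)
import Data.Fin.Properties as FinP
open import Data.Bool using (true; false; if_then_else_)
open import Data.Maybe using (just; nothing)
open import Data.Maybe.Properties using (just-injective)
open import Data.Product using (∃; ∃₂; _×_; _,_; proj₂)
open import Data.Sum using (_⊎_; inj₁; inj₂)
open import Data.Empty using (⊥-elim)
open import Data.Unit using (tt)
open import Data.List as List using (List; []; _∷_; reverse)
open import Data.List.Properties using (unfold-reverse)
open import Data.List.Membership.Propositional using (_∈_)
open import Data.List.Membership.Propositional.Properties using (∈-lookup; ∈-filter⁺; ∈-filter⁻)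
open import Data.List.Relation.Unary.Any using (here; there; any?)
open import Data.List.Relation.Unary.Any.Properties using () renaming (reverse⁻ to Any-reverse⁻)
open import Data.List.Relation.Unary.All as All using (All; []; _∷_)
open import Data.List.Relation.Unary.AllPairs using (AllPairs; []; _∷_)
open import Data.List.Relation.Unary.AllPairs.Properties using () renaming (++⁺ to AllPairs-++⁺)
open import Function using (flip; _∘′_)
open import Relation.Nullary using (¬_; Dec; yes; no; does)
open import Relation.Nullary.Decidable using (¬?; dec-true; dec-false)
open import Relation.Binary.PropositionalEquality

module Floor where

  ι : ℤ → ℚ
  ι k = mkℚ k 0 (coprime-sym (1-coprimeTo _))

  ι-mono : ∀ {a b} → a ℤ.≤ b → ι a ℚ.≤ ι b
  ι-mono {a} {b} a≤b =
    ℚ.*≤* (subst₂ ℤ._≤_ (sym (ℤP.*-identityʳ a)) (sym (ℤP.*-identityʳ b)) a≤b)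

  ι-suc : ∀ k → ι (k ℤ.+ ℤ.1ℤ) ≡ ι k ℚ.+ 1ℚ
  ι-suc k = ℚP.toℚᵘ-injective
    (ℚᵘP.≃-trans (ℚᵘ.*≡* cross) (ℚᵘP.≃-sym (ℚP.toℚᵘ-homo-+ (ι k) 1ℚ)))
    where
    cross : (k ℤ.+ ℤ.1ℤ) ℤ.* (ℤ.1ℤ ℤ.* ℤ.1ℤ) ≡ (k ℤ.* ℤ.1ℤ ℤ.+ ℤ.1ℤ ℤ.* ℤ.1ℤ) ℤ.* ℤ.1ℤ
    cross rewrite ℤP.*-identityʳ k = refl

  floor-≤ : ∀ p → ι (floor p) ℚ.≤ p
  floor-≤ p@(mkℚ n d _) =
    ℚ.*≤* (subst (floor p ℤ.* ↧ p ℤ.≤_) (sym (ℤP.*-identityʳ n)) (ℤD.[n/d]*d≤n n (↧ p)))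

  floor-> : ∀ p → p ℚ.< ι (floor p ℤ.+ ℤ.1ℤ)
  floor-> p@(mkℚ n d _) =
    ℚ.*<* (subst₂ ℤ._<_ (sym (ℤP.*-identityʳ n)) (cong (ℤ._* ↧ p) suc-floor)
                         (ℤD.n<s[n/ℕd]*d n (ℕ.suc d)))
    where
    suc-floor : ℤ.suc (n ℤD./ℕ ℕ.suc d) ≡ floor p ℤ.+ ℤ.1ℤ
    suc-floor = trans (cong ℤ.suc (sym (ℤD.div-pos-is-/ℕ n (ℕ.suc d))))
                      (ℤP.+-comm ℤ.1ℤ (floor p))

  floor-mono : ∀ {p q} → p ℚ.≤ q → floor p ℤ.≤ floor q
  floor-mono {p} {q} p≤q with floor p ℤ.≤? floor q
  ... | yes le = le
  ... | no ≰ = ⊥-elim (ℚP.<-irrefl refl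
        (ℚP.<-≤-trans (floor-> q) (ℚP.≤-trans (ι-mono step) (ℚP.≤-trans (floor-≤ p) p≤q))))
    where
    step : floor q ℤ.+ ℤ.1ℤ ℤ.≤ floor p
    step = subst (ℤ._≤ floor p) (ℤP.+-comm ℤ.1ℤ (floor q)) (ℤP.i<j⇒suc[i]≤j (ℤP.≰⇒> ≰))

  floor-≤⇒<+1 : ∀ p q → floor p ℤ.≤ floor q → p ℚ.< q ℚ.+ 1ℚ
  floor-≤⇒<+1 p q le =
    ℚP.<-≤-trans (floor-> p)
      (ℚP.≤-trans (ι-mono (ℤP.+-monoˡ-≤ ℤ.1ℤ le))
        (ℚP.≤-trans (ℚP.≤-reflexive (ι-suc (floor q))) (ℚP.+-monoˡ-≤ 1ℚ (floor-≤ q))))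

module ScaledKey (δ : ℚ) (δ>0 : 0ℚ ℚ.< δ) where
  open Floor

  private
    instance
      δ≢0 : ℚ.NonZero δ
      δ≢0 = ℚ.>-nonZero δ>0
      1/δ>0 : ℚ.Positive (ℚ.1/ δ)
      1/δ>0 = ℚP.1/pos⇒pos δ {{ℚ.positive δ>0}}

  key : ℚ → ℤ
  key = scaledKey δ δ>0

  ÷δ*δ : ∀ a → (a ÷ δ) ℚ.* δ ≡ a
  ÷δ*δ a = trans (ℚP.*-assoc a (ℚ.1/ δ) δ)
                 (trans (cong (a ℚ.*_) (ℚP.*-inverseˡ δ)) (ℚP.*-identityʳ a))

  key-mono : ∀ {a b} → a ℚ.≤ b → key a ℤ.≤ key b
  key-mono a≤b = floor-mono (ℚP.*-monoʳ-≤-nonNeg (ℚ.1/ δ) {{ℚP.pos⇒nonNeg (ℚ.1/ δ)}} a≤b)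

  key-≤⇒<+δ : ∀ a b → key a ℤ.≤ key b → a ℚ.< b ℚ.+ δ
  key-≤⇒<+δ a b le =
    subst₂ ℚ._<_ (÷δ*δ a) scale-back
      (ℚP.*-monoˡ-<-pos δ {{ℚ.positive δ>0}} (floor-≤⇒<+1 (a ÷ δ) (b ÷ δ) le))
    where
    scale-back : ((b ÷ δ) ℚ.+ 1ℚ) ℚ.* δ ≡ b ℚ.+ δ
    scale-back = trans (ℚP.*-distribʳ-+ δ (b ÷ δ) 1ℚ) (cong₂ ℚ._+_ (÷δ*δ b) (ℚP.*-identityˡ δ))

keyOf-∈ : ∀ m k c → (m , k) ∈ c → ∃ λ k′ → keyOf m c ≡ just k′ × (m , k′) ∈ c
keyOf-∈ m k ((w , k₀) ∷ c) mem with w ℕ.≟ m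
... | yes refl rewrite dec-true (m ℕ.≟ m) refl = k₀ , refl , here refl
... | no w≢m rewrite dec-false (w ℕ.≟ m) w≢m with mem
...   | here refl = ⊥-elim (w≢m refl)
...   | there mem′ = let (k′ , found , mem″) = keyOf-∈ m k c mem′ in k′ , found , there mem″

lastExtKey-ext : ∀ h m k → keyOf m (contents h) ≡ just k → lastExtKey (ext m ∷ h) ≡ just k
lastExtKey-ext h m k found rewrite found = refl

∈-remove⁺ : ∀ {m k v c} → (m , k) ∈ c → ¬ m ≡ v → (m , k) ∈ remove v c
∈-remove⁺ {v = v} mem m≢v = ∈-filter⁺ (λ p → ¬? (proj₁ p ℕ.≟ v)) mem m≢v

∈-remove⁻ : ∀ {m k v c} → (m , k) ∈ remove v c → (m , k) ∈ c × ¬ m ≡ v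
∈-remove⁻ {v = v} mem = ∈-filter⁻ (λ p → ¬? (proj₁ p ℕ.≟ v)) mem

AllPairs-lookup : ∀ {A : Set} {R : A → A → Set} {xs : List A} → AllPairs R xs →
  (i j : Fin (length xs)) → i Fin.< j → R (lookup xs i) (lookup xs j)
AllPairs-lookup {xs = x ∷ xs} (x~xs ∷ _) Fin.zero (Fin.suc j) _ = All.lookup x~xs (∈-lookup j)
AllPairs-lookup {xs = x ∷ xs} (_ ∷ xs-pairs) (Fin.suc i) (Fin.suc j) (ℕ.s≤s i<j) =
  AllPairs-lookup xs-pairs i j i<j

All-reverse : ∀ {A : Set} {P : A → Set} {xs : List A} → All P xs → All P (reverse xs)
All-reverse all = All.tabulate (λ mem → All.lookup all (Any-reverse⁻ mem))

AllPairs-reverse : ∀ {A : Set} {R : A → A → Set} {xs : List A} →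
  AllPairs R xs → AllPairs (flip R) (reverse xs)
AllPairs-reverse {xs = []} [] = []
AllPairs-reverse {xs = x ∷ xs} (x~xs ∷ xs-pairs) rewrite unfold-reverse x xs =
  AllPairs-++⁺ (AllPairs-reverse xs-pairs) ([] ∷ []) (All.map (λ r → r ∷ []) (All-reverse x~xs))

open RatG

setAt-same : ∀ {n} {B : Set} (f : Fin n → B) u b → setAt f u b u ≡ b
setAt-same f u b rewrite dec-true (u Fin.≟ u) refl = refl

setAt-cases : ∀ {n} {B : Set} (f : Fin n → B) u b w →
  (w ≡ u × setAt f u b w ≡ b) ⊎ (¬ w ≡ u × setAt f u b w ≡ f w)
setAt-cases f u b w with w Fin.≟ u
... | yes w≡u = inj₁ (w≡u , refl)
... | no w≢u = inj₂ (w≢u , refl)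

does-true : ∀ {A : Set} (d : Dec A) → does d ≡ true → A
does-true (yes a) _ = a
does-true (no _) ()

does-false : ∀ {A : Set} (d : Dec A) → does d ≡ false → ¬ A
does-false (yes _) ()
does-false (no ¬a) _ = ¬a

improves-true : ∀ {x y} → improves (just x) y ≡ true → y ℚ.< x
improves-true {x} {y} imp = does-true (y ℚP.<? x) imp

improves-false : ∀ {mx y} → improves mx y ≡ false → ∃ λ x → mx ≡ just x × x ℚ.≤ y
improves-false {nothing} ()
improves-false {just x} {y} imp =
  x , refl , ℚP.≮⇒≥ (does-false (y ℚP.<? x) imp)

module ScaledDijkstra (H : PQueue) (H-monotone : MonotoneIntPQ H)
                      {n : ℕ} (s : Fin n) (E : Edges n)
                      (δ : ℚ) (δ>0 : 0ℚ ℚ.< δ)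
                      (δ≤E : All (λ e → δ ℚ.≤ proj₂ (proj₂ e)) E) where
  open ScaledKey δ δ>0
  open Run key H s E
  open State

  WalkTo : Fin n → ℚ → Set
  WalkTo = Walk s E

  Dist : Fin n → ℚ → Set
  Dist = IsDist s E

  δ≤ℓ : ∀ {a u ℓ} → (a , u , ℓ) ∈ E → δ ℚ.≤ ℓ
  δ≤ℓ = All.lookup δ≤E

  ≤+ : ∀ x {ℓ} → δ ℚ.≤ ℓ → x ℚ.≤ x ℚ.+ ℓ
  ≤+ x {ℓ} δ≤ℓ′ = subst (ℚ._≤ x ℚ.+ ℓ) (ℚP.+-identityʳ x)
                       (ℚP.+-monoʳ-≤ x (ℚP.≤-trans (ℚP.<⇒≤ δ>0) δ≤ℓ′))

  Shortest : Fin n → ℚ → Set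
  Shortest w x = ∀ y → WalkTo w y → x ℚ.≤ y

  dist-unique : ∀ {v dv y} → WalkTo v dv → Shortest v dv → Dist v y → y ≡ dv
  dist-unique wv dv-min (wy , y-min) = ℚP.≤-antisym (y-min _ wv) (dv-min _ wy)

  -- membership of nodes in a list is decided as in relax
  _∈?_ : ∀ (a : Fin n) l → Dec (a ∈ l)
  a ∈? l = any? (a Fin.≟_) l

  MinimalKey : List Op → ℤ → Set
  MinimalKey h k = ∀ p → p ∈ contents h → k ℤ.≤ proj₂ p

  KeyLe : Fin n → Fin n → Set
  KeyLe a b = ∀ x y → Dist a x → Dist b y → key x ℤ.≤ key y

  BelowLast : List Op → Fin n → Set
  BelowLast h a = ∃ λ L → lastExtKey h ≡ just L × ∀ x → Dist a x → key x ℤ.≤ L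

  -- Invariant on the bookkeeping of a state; it is preserved by every step.
  -- (The processing order is stored newest first, hence flip KeyLe.)
  record QueueInvariant (st : State n) : Set where
    field
      D-walk : ∀ w x → D st w ≡ just x → WalkTo w x
      done-exact : ∀ a → a ∈ done st → ∃ λ x → D st a ≡ just x × Shortest a x
      queued : ∀ b z → ¬ b ∈ done st → D st b ≡ just z → (toℕ b , key z) ∈ contents (hist st)
      queue-sound : ∀ m k → (m , k) ∈ contents (hist st) →
        ∃₂ λ b z → toℕ b ≡ m × ¬ b ∈ done st × D st b ≡ just z × k ≡ key z
      monotone-use : MonoUse (hist st)
      queue-above-last : ∀ p → p ∈ contents (hist st) → AtLeast (lastExtKey (hist st)) (proj₂ p)
      order-sorted : AllPairs (flip KeyLe) (order st)
      order-below-last : All (BelowLast (hist st)) (order st)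

  record DijkstraInvariant (st : State n) : Set where
    field
      queue : QueueInvariant st
      relaxed : ∀ u du w ℓ → u ∈ done st → D st u ≡ just du → (u , w , ℓ) ∈ E →
        ∃ λ z → D st w ≡ just z × z ℚ.≤ du ℚ.+ ℓ
      source-reached : ∃ λ z → D st s ≡ just z × z ℚ.≤ 0ℚ
  open QueueInvariant
  open DijkstraInvariant

  Frontier : State n → Fin n → ℚ → Set
  Frontier st w y = ∃₂ λ b z → ¬ b ∈ done st × D st b ≡ just z × z ℚ.≤ y × (b ≡ w ⊎ z ℚ.+ δ ℚ.≤ y)

  -- Induction on the walk: if its last edge (u, w, ℓ) leaves a processed u
  -- then w itself is a frontier node as the edge is relaxed; otherwise the
  -- frontier node of the prefix is at least ℓ ≥ δ shorter.
  frontier : ∀ st → DijkstraInvariant st → ∀ {w y} → WalkTo w y → ¬ w ∈ done st → Frontier st w y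
  frontier st I here s∉ = let (z , Ds , z≤0) = source-reached I in s , z , s∉ , Ds , z≤0 , inj₁ refl
  frontier st I (there {u} {w} {x} {ℓ} p e) w∉ with u ∈? done st
  ... | yes u∈ = let (du , Du , du-min) = done-exact (queue I) u u∈
                     (z , Dw , z≤) = relaxed I u du w ℓ u∈ Du e
                 in w , z , w∉ , Dw , ℚP.≤-trans z≤ (ℚP.+-monoˡ-≤ ℓ (du-min x p)) , inj₁ refl
  ... | no u∉ = let (b , z , b∉ , Db , z≤x , _) = frontier st I p u∉
                    z+δ≤ = ℚP.+-mono-≤ z≤x (δ≤ℓ e)
                in b , z , b∉ , Db , ℚP.≤-trans (≤+ z ℚP.≤-refl) z+δ≤ , inj₂ z+δ≤

  -- The unprocessed node extracted with minimal key has its exact distance.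
  -- Its frontier node b is v itself, or D(v) < D(b) + δ ≤ y by the key bound.
  extracted-is-final : ∀ st → DijkstraInvariant st → ∀ v dv → ¬ v ∈ done st → D st v ≡ just dv →
    MinimalKey (hist st) (key dv) → Shortest v dv
  extracted-is-final st I v dv v∉ Dv minimal y p with frontier st I p v∉
  ... | b , z , b∉ , Db , z≤y , inj₁ refl = subst (ℚ._≤ y) (just-injective (trans (sym Db) Dv)) z≤y
  ... | b , z , b∉ , Db , z≤y , inj₂ z+δ≤y =
        ℚP.<⇒≤ (ℚP.<-≤-trans (key-≤⇒<+δ dv z (minimal _ (queued (queue I) b z b∉ Db))) z+δ≤y)

  Decreases : State n → State n → Set
  Decreases st st′ = ∀ w z → D st w ≡ just z → ∃ λ z′ → D st′ w ≡ just z′ × z′ ℚ.≤ z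

  Decreases-refl : ∀ st → Decreases st st
  Decreases-refl st w z Dw = z , Dw , ℚP.≤-refl

  Decreases-trans : ∀ {st₁ st₂ st₃} → Decreases st₁ st₂ → Decreases st₂ st₃ → Decreases st₁ st₃
  Decreases-trans d₁₂ d₂₃ w z Dw =
    let (z₁ , D₂w , z₁≤) = d₁₂ w z Dw
        (z₂ , D₃w , z₂≤) = d₂₃ w z₁ D₂w
    in z₂ , D₃w , ℚP.≤-trans z₂≤ z₁≤

  module Relaxation (v : Fin n) (dv : ℚ) where

    update : State n → Fin n → ℚ → State n
    update st u ℓ = record st
      { D    = setAt (D st) u (just (dv ℚ.+ ℓ))
      ; par  = setAt (par st) u (just v)
      ; hist = if does (any? (u Fin.≟_) (done st)) then hist st
               else upd (toℕ u) (key (dv ℚ.+ ℓ)) ∷ hist st }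

    update′ : State n → Fin n → ℚ → State n
    update′ st u ℓ = record st
      { D    = setAt (D st) u (just (dv ℚ.+ ℓ))
      ; par  = setAt (par st) u (just v)
      ; hist = upd (toℕ u) (key (dv ℚ.+ ℓ)) ∷ hist st }

    update-unprocessed : ∀ st u ℓ → ¬ u ∈ done st → update st u ℓ ≡ update′ st u ℓ
    update-unprocessed st u ℓ u∉ =
      cong (λ h → record (update′ st u ℓ) { hist = h }) (if-false (dec-false (u ∈? done st) u∉))
      where
      if-false : ∀ {b} {x y : List Op} → b ≡ false → (if b then x else y) ≡ y
      if-false refl = refl

    relax-cases : ∀ (Q : State n → Set) st e
      → ((∀ u ℓ → e ≡ (v , u , ℓ) → improves (D st u) (dv ℚ.+ ℓ) ≡ false) → Q st)
      → (∀ u ℓ → e ≡ (v , u , ℓ) → improves (D st u) (dv ℚ.+ ℓ) ≡ true → Q (update st u ℓ))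
      → Q (relax dv v st e)
    relax-cases Q st (a , u , ℓ) unchanged improved with a Fin.≟ v
    ... | no a≢v = unchanged (λ { _ _ refl → ⊥-elim (a≢v refl) })
    ... | yes refl with improves (D st u) (dv ℚ.+ ℓ) in imp
    ...   | true = improved u ℓ refl imp
    ...   | false = unchanged (λ { _ _ refl → imp })

    -- an improving edge never points to a processed node, as their D is exact
    improved-unprocessed : ∀ st u ℓ → QueueInvariant st → WalkTo v dv → (v , u , ℓ) ∈ E →
      improves (D st u) (dv ℚ.+ ℓ) ≡ true → ¬ u ∈ done st
    improved-unprocessed st u ℓ Q wv e imp u∈ with done-exact Q u u∈
    ... | x , Du , x-min = ℚP.<-irrefl refl (ℚP.≤-<-trans (x-min _ (there wv e))
          (improves-true (subst (λ m → improves m (dv ℚ.+ ℓ) ≡ true) Du imp)))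

    -- Updating an unprocessed u along an edge (v, u, ℓ) preserves the queue
    -- invariant; the new key is ≥ key dv, the last extracted key.
    update-invariant : ∀ st u ℓ → QueueInvariant st → (v , u , ℓ) ∈ E → WalkTo v dv →
      lastExtKey (hist st) ≡ just (key dv) → ¬ u ∈ done st → QueueInvariant (update′ st u ℓ)
    update-invariant st u ℓ Q e wv last u∉ = record
      { D-walk = D-walk′ ; done-exact = done-exact′ ; queued = queued′ ; queue-sound = queue-sound′
      ; monotone-use = monotone-use Q , new-key-above ; queue-above-last = queue-above-last′
      ; order-sorted = order-sorted Q ; order-below-last = order-below-last Q }
      where
      st′ : State n
      st′ = update′ st u ℓ
      new-key-above : AtLeast (lastExtKey (hist st)) (key (dv ℚ.+ ℓ))
      new-key-above rewrite last = key-mono (≤+ dv (δ≤ℓ e))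
      D-walk′ : ∀ w x → D st′ w ≡ just x → WalkTo w x
      D-walk′ w x Dw with setAt-cases (D st) u (just (dv ℚ.+ ℓ)) w
      ... | inj₁ (refl , new) = subst (WalkTo w) (just-injective (trans (sym new) Dw)) (there wv e)
      ... | inj₂ (_ , old) = D-walk Q w x (trans (sym old) Dw)
      done-exact′ : ∀ a → a ∈ done st′ → ∃ λ x → D st′ a ≡ just x × Shortest a x
      done-exact′ a a∈ with setAt-cases (D st) u (just (dv ℚ.+ ℓ)) a
      ... | inj₁ (refl , _) = ⊥-elim (u∉ a∈)
      ... | inj₂ (_ , old) = let (x , Da , x-min) = done-exact Q a a∈ in x , trans old Da , x-min
      queued′ : ∀ b z → ¬ b ∈ done st′ → D st′ b ≡ just z → (toℕ b , key z) ∈ contents (hist st′)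
      queued′ b z b∉ Db with setAt-cases (D st) u (just (dv ℚ.+ ℓ)) b
      ... | inj₁ (refl , new) =
            here (cong (λ x → toℕ b , key x) (just-injective (trans (sym Db) new)))
      ... | inj₂ (b≢u , old) =
            there (∈-remove⁺ (queued Q b z b∉ (trans (sym old) Db)) (b≢u ∘′ FinP.toℕ-injective))
      queue-sound′ : ∀ m k → (m , k) ∈ contents (hist st′) →
        ∃₂ λ b z → toℕ b ≡ m × ¬ b ∈ done st′ × D st′ b ≡ just z × k ≡ key z
      queue-sound′ m k (here refl) = u , dv ℚ.+ ℓ , refl , u∉ , setAt-same (D st) u _ , refl
      queue-sound′ m k (there mem) with ∈-remove⁻ mem
      ... | mem₀ , m≢u with queue-sound Q m k mem₀
      ...   | b , z , refl , b∉ , Db , k≡ with setAt-cases (D st) u (just (dv ℚ.+ ℓ)) b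
      ...     | inj₁ (refl , _) = ⊥-elim (m≢u refl)
      ...     | inj₂ (_ , old) = b , z , refl , b∉ , trans old Db , k≡
      queue-above-last′ : ∀ p → p ∈ contents (hist st′) → AtLeast (lastExtKey (hist st′)) (proj₂ p)
      queue-above-last′ p (here refl) = new-key-above
      queue-above-last′ p (there mem) = queue-above-last Q p (proj₁ (∈-remove⁻ mem))

    relax-invariant : ∀ st e → e ∈ E → QueueInvariant st → WalkTo v dv →
      lastExtKey (hist st) ≡ just (key dv) →
      QueueInvariant (relax dv v st e) × lastExtKey (hist (relax dv v st e)) ≡ just (key dv)
    relax-invariant st e e∈E Q wv last =
      relax-cases Goal st e (λ _ → Q , last) improved
      where
      Goal : State n → Set
      Goal st′ = QueueInvariant st′ × lastExtKey (hist st′) ≡ just (key dv)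
      improved : ∀ u ℓ → e ≡ (v , u , ℓ) → improves (D st u) (dv ℚ.+ ℓ) ≡ true → Goal (update st u ℓ)
      improved u ℓ refl imp = subst Goal (sym (update-unprocessed st u ℓ u∉))
                                    (update-invariant st u ℓ Q e∈E wv last u∉ , last)
        where
        u∉ : ¬ u ∈ done st
        u∉ = improved-unprocessed st u ℓ Q wv e∈E imp

    relax-decreases : ∀ st e → Decreases st (relax dv v st e)
    relax-decreases st e = relax-cases (Decreases st) st e (λ _ → Decreases-refl st) improved
      where
      improved : ∀ u ℓ → e ≡ (v , u , ℓ) → improves (D st u) (dv ℚ.+ ℓ) ≡ true →
        Decreases st (update st u ℓ)
      improved u ℓ _ imp w z Dw with setAt-cases (D st) u (just (dv ℚ.+ ℓ)) w
      ... | inj₁ (refl , new) = dv ℚ.+ ℓ , new ,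
            ℚP.<⇒≤ (improves-true (subst (λ m → improves m (dv ℚ.+ ℓ) ≡ true) Dw imp))
      ... | inj₂ (_ , old) = z , trans old Dw , ℚP.≤-refl

    relax-edge : ∀ st w ℓ → ∃ λ z → D (relax dv v st (v , w , ℓ)) w ≡ just z × z ℚ.≤ dv ℚ.+ ℓ
    relax-edge st w ℓ =
      relax-cases (λ st′ → ∃ λ z → D st′ w ≡ just z × z ℚ.≤ dv ℚ.+ ℓ) st (v , w , ℓ)
        (λ unchanged → improves-false (unchanged w ℓ refl))
        (λ { _ _ refl _ → dv ℚ.+ ℓ , setAt-same (D st) w _ , ℚP.≤-refl })

    relax-done : ∀ st e → done (relax dv v st e) ≡ done st
    relax-done st e = relax-cases (λ st′ → done st′ ≡ done st) st e (λ _ → refl) (λ _ _ _ _ → refl)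

    relaxAll : State n → List (Fin n × Fin n × ℚ) → State n
    relaxAll = List.foldl (relax dv v)

    relaxAll-invariant : ∀ L st → (∀ {e} → e ∈ L → e ∈ E) → QueueInvariant st → WalkTo v dv →
      lastExtKey (hist st) ≡ just (key dv) → QueueInvariant (relaxAll st L)
    relaxAll-invariant [] st _ Q _ _ = Q
    relaxAll-invariant (e ∷ L) st L⊆E Q wv last =
      let (Q′ , last′) = relax-invariant st e (L⊆E (here refl)) Q wv last in
      relaxAll-invariant L (relax dv v st e) (L⊆E ∘′ there) Q′ wv last′

    relaxAll-decreases : ∀ L st → Decreases st (relaxAll st L)
    relaxAll-decreases [] st = Decreases-refl st
    relaxAll-decreases (e ∷ L) st =
      Decreases-trans {st} {relax dv v st e} {relaxAll (relax dv v st e) L}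
        (relax-decreases st e) (relaxAll-decreases L (relax dv v st e))

    relaxAll-done : ∀ L st → done (relaxAll st L) ≡ done st
    relaxAll-done [] st = refl
    relaxAll-done (e ∷ L) st = trans (relaxAll-done L (relax dv v st e)) (relax-done st e)

    relaxAll-edge : ∀ L st w ℓ → (v , w , ℓ) ∈ L →
      ∃ λ z → D (relaxAll st L) w ≡ just z × z ℚ.≤ dv ℚ.+ ℓ
    relaxAll-edge (e ∷ L) st w ℓ (here refl) =
      let (z , Dw , z≤) = relax-edge st w ℓ
          (z′ , D′w , z′≤) = relaxAll-decreases L (relax dv v st e) w z Dw
      in z′ , D′w , ℚP.≤-trans z′≤ z≤
    relaxAll-edge (e ∷ L) st w ℓ (there mem) = relaxAll-edge L (relax dv v st e) w ℓ mem

  markProcessed : State n → Fin n → State n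
  markProcessed st v = record st
    { done = v ∷ done st ; hist = ext (toℕ v) ∷ hist st ; order = v ∷ order st }

  process-unfold : ∀ st v dv → D st v ≡ just dv →
    process st v ≡ Relaxation.relaxAll v dv (markProcessed st v) E
  process-unfold st v dv Dv with D st v | Dv
  ... | just .dv | refl = refl

  extracted-key : ∀ st v dv k → QueueInvariant st → D st v ≡ just dv →
    (toℕ v , k) ∈ contents (hist st) → lastExtKey (hist (markProcessed st v)) ≡ just (key dv)
  extracted-key st v dv k Q Dv mem with keyOf-∈ (toℕ v) k (contents (hist st)) mem
  ... | k′ , found , mem′ with queue-sound Q (toℕ v) k′ mem′
  ...   | b , z , b≡v , _ , Db , k′≡ with FinP.toℕ-injective b≡v
  ...     | refl = trans (lastExtKey-ext (hist st) (toℕ b) k′ found)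
                         (cong just (trans k′≡ (cong key (just-injective (trans (sym Db) Dv)))))

  -- Marking the extracted node v processed preserves the queue invariant:
  -- its key bounds all keys before it and is the new last extracted key.
  extract-invariant : ∀ st v dv → QueueInvariant st → D st v ≡ just dv →
    Shortest v dv → (toℕ v , key dv) ∈ contents (hist st) →
    MinimalKey (hist st) (key dv) →
    QueueInvariant (markProcessed st v) × lastExtKey (hist (markProcessed st v)) ≡ just (key dv)
  extract-invariant st v dv Q Dv dv-min mem minimal = Q′ , last
    where
    last : lastExtKey (hist (markProcessed st v)) ≡ just (key dv)
    last = extracted-key st v dv (key dv) Q Dv mem
    previous≤ : ∀ {L} → lastExtKey (hist st) ≡ just L → L ℤ.≤ key dv
    previous≤ previous = subst (λ m → AtLeast m (key dv)) previous (queue-above-last Q _ mem)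
    key-of-v : ∀ y → Dist v y → key y ≡ key dv
    key-of-v y dist = cong key (dist-unique (D-walk Q v dv Dv) dv-min dist)
    above-previous : ∀ {a} → BelowLast (hist st) a → KeyLe a v
    above-previous (L , previous , a≤L) x y dist-a dist-v =
      ℤP.≤-trans (a≤L x dist-a)
        (ℤP.≤-trans (previous≤ previous) (ℤP.≤-reflexive (sym (key-of-v y dist-v))))
    below-new : ∀ {a} → BelowLast (hist st) a → BelowLast (hist (markProcessed st v)) a
    below-new (L , previous , a≤L) =
      key dv , last , λ x dist → ℤP.≤-trans (a≤L x dist) (previous≤ previous)
    Q′ : QueueInvariant (markProcessed st v)
    Q′ = record
      { D-walk = D-walk Q
      ; done-exact = λ { a (here refl) → dv , Dv , dv-min ; a (there a∈) → done-exact Q a a∈ }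
      ; queued = λ b z b∉ Db → ∈-remove⁺ (queued Q b z (b∉ ∘′ there) Db)
                                          (λ b≡v → b∉ (here (FinP.toℕ-injective b≡v)))
      ; queue-sound = λ m k mem′ →
          let (mem₀ , m≢v) = ∈-remove⁻ mem′
              (b , z , b≡m , b∉ , Db , k≡) = queue-sound Q m k mem₀
          in b , z , b≡m
             , (λ { (here b≡v) → m≢v (trans (sym b≡m) (cong toℕ b≡v)) ; (there b∈) → b∉ b∈ })
             , Db , k≡
      ; monotone-use = monotone-use Q
      ; queue-above-last = λ p mem′ →
          subst (λ m → AtLeast m (proj₂ p)) (sym last) (minimal p (proj₁ (∈-remove⁻ mem′)))
      ; order-sorted = All.map above-previous (order-below-last Q) ∷ order-sorted Q
      ; order-below-last = (key dv , last , λ y dist → ℤP.≤-reflexive (key-of-v y dist))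
                           ∷ All.map below-new (order-below-last Q)
      }

  process-invariant : ∀ st v dv → DijkstraInvariant st → ¬ v ∈ done st → D st v ≡ just dv →
    (toℕ v , key dv) ∈ contents (hist st) → MinimalKey (hist st) (key dv) →
    DijkstraInvariant (process st v)
  process-invariant st v dv I v∉ Dv mem minimal =
    subst DijkstraInvariant (sym (process-unfold st v dv Dv)) I′
    where
    open Relaxation v dv
    dv-min : Shortest v dv
    dv-min = extracted-is-final st I v dv v∉ Dv minimal
    st₁ : State n
    st₁ = markProcessed st v
    st₂ : State n
    st₂ = relaxAll st₁ E
    extracted : QueueInvariant st₁ × lastExtKey (hist st₁) ≡ just (key dv)
    extracted = extract-invariant st v dv (queue I) Dv dv-min mem minimal
    Q₂ : QueueInvariant st₂
    Q₂ = relaxAll-invariant E st₁ (λ e∈ → e∈) (proj₁ extracted) (D-walk (queue I) v dv Dv)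
                            (proj₂ extracted)
    decreases : Decreases st st₂
    decreases = relaxAll-decreases E st₁
    stays-exact : ∀ u du₀ du → D st u ≡ just du₀ → Shortest u du₀ →
      D st₂ u ≡ just du → du ≡ du₀
    stays-exact u du₀ du Du₀ du₀-min Du with decreases u du₀ Du₀
    ... | z , Dz , z≤ = ℚP.≤-antisym (subst (ℚ._≤ du₀) (just-injective (trans (sym Dz) Du)) z≤)
                                    (du₀-min du (D-walk Q₂ u du Du))
    relaxed′ : ∀ u du w ℓ → u ∈ v ∷ done st → D st₂ u ≡ just du → (u , w , ℓ) ∈ E →
      ∃ λ z → D st₂ w ≡ just z × z ℚ.≤ du ℚ.+ ℓ
    relaxed′ u du w ℓ (here refl) Du e with stays-exact v dv du Dv dv-min Du
    ... | refl = relaxAll-edge E st₁ w ℓ e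
    relaxed′ u du w ℓ (there u∈) Du e with done-exact (queue I) u u∈
    ... | du₀ , Du₀ , du₀-min with stays-exact u du₀ du Du₀ du₀-min Du
    ...   | refl = let (z , Dw , z≤) = relaxed I u du₀ w ℓ u∈ Du₀ e
                       (z′ , D′w , z′≤) = decreases w z Dw
                   in z′ , D′w , ℚP.≤-trans z′≤ z≤
    I′ : DijkstraInvariant st₂
    I′ = record
      { queue = Q₂
      ; relaxed = λ u du w ℓ u∈ → relaxed′ u du w ℓ (subst (u ∈_) (relaxAll-done E st₁) u∈)
      ; source-reached = let (z , Ds , z≤) = source-reached I ; (z′ , D′s , z′≤) = decreases s z Ds
                         in z′ , D′s , ℚP.≤-trans z′≤ z≤ }

  -- One step extracts the node v reported by H.  By monotonicity of H its
  -- key is minimal, and by queue soundness it is an unprocessed node with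
  -- key ⌊D(v)/δ⌋, so process-invariant applies.
  step-invariant : ∀ st → DijkstraInvariant st → DijkstraInvariant (step st)
  step-invariant st I with H n (hist st) in reported
  ... | nothing = I
  ... | just m with m ℕ.<? n
  ...   | no _ = I
  ...   | yes m<n
    with subst (λ r → ExtractSpec r (contents (hist st))) reported
               (H-monotone n (hist st) (monotone-use (queue I)))
  ...     | k , mem , k-min with queue-sound (queue I) m k mem
  ...       | v , dv , v≡m , v∉ , Dv , refl
    with FinP.toℕ-injective {i = v} {j = fromℕ< m<n} (trans v≡m (sym (FinP.toℕ-fromℕ< m<n)))
  ...         | refl = process-invariant st v dv I v∉ Dv
                         (subst (λ t → (t , key dv) ∈ contents (hist st)) (sym v≡m) mem)
                         (λ _ → All.lookup k-min)

  iterate-invariant : ∀ k st → DijkstraInvariant st → DijkstraInvariant (iter k st)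
  iterate-invariant ℕ.zero st I = I
  iterate-invariant (ℕ.suc k) st I = iterate-invariant k (step st) (step-invariant st I)

  init-D : ∀ w → (w ≡ s × D init w ≡ just 0ℚ) ⊎ D init w ≡ nothing
  init-D w with w Fin.≟ s
  ... | yes w≡s = inj₁ (w≡s , refl)
  ... | no _ = inj₂ refl

  init-D-source : D init s ≡ just 0ℚ
  init-D-source rewrite dec-true (s Fin.≟ s) refl = refl

  init-invariant : DijkstraInvariant init
  init-invariant = record
    { queue = record
      { D-walk = D-walk₀
      ; done-exact = λ _ ()
      ; queued = queued₀
      ; queue-sound = λ { _ _ (here refl) → s , 0ℚ , refl , (λ ()) , init-D-source , refl }
      ; monotone-use = tt , tt
      ; queue-above-last = λ _ _ → tt
      ; order-sorted = []
      ; order-below-last = [] }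
    ; relaxed = λ _ _ _ _ ()
    ; source-reached = 0ℚ , init-D-source , ℚP.≤-refl }
    where
    D-walk₀ : ∀ w x → D init w ≡ just x → WalkTo w x
    D-walk₀ w x Dw with init-D w
    ... | inj₁ (refl , D₀) = subst (WalkTo w) (just-injective (trans (sym D₀) Dw)) here
    ... | inj₂ D₀ with () ← trans (sym D₀) Dw
    queued₀ : ∀ b z → ¬ b ∈ done init → D init b ≡ just z → (toℕ b , key z) ∈ contents (hist init)
    queued₀ b z _ Db with init-D b
    ... | inj₁ (refl , D₀) = here (cong (λ x → toℕ b , key x) (just-injective (trans (sym Db) D₀)))
    ... | inj₂ D₀ with () ← trans (sym D₀) Db

  processingOrder-sorted : AllPairs KeyLe processingOrder
  processingOrder-sorted =
    AllPairs-reverse (order-sorted (queue (iterate-invariant n init init-invariant)))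

-- Sorted keys within δ of each other give the δ-PO property.
theorem2 : (H : PQueue) → MonotoneIntPQ H → FullOrderingOnIntegerPSSSP H →
    (n : ℕ) (s : Fin n) (E : RatG.Edges n) (δ : ℚ) (hδ : IsMinLength E δ) →
    let ord = ratOrder H n s E δ (proj₁ hδ) in
    ∀ (i j : Fin (length ord)) → i Fin.< j →
    ∀ x y → RatG.IsDist s E (lookup ord i) x → RatG.IsDist s E (lookup ord j) y →
    x ℚ.< y ℚ.+ δ
theorem2 H H-monotone _ n s E δ (δ>0 , δ≤E , _) i j i<j x y dist-x dist-y =
  key-≤⇒<+δ x y (AllPairs-lookup processingOrder-sorted i j i<j x y dist-x dist-y)
  where
  open ScaledKey δ δ>0
  open ScaledDijkstra H H-monotone s E δ δ>0 δ≤E
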